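{- Let $k,d$ be positive integers and let $\Gamma$ be a finite, simple, strongly connected digraph with $\dim(\Gamma)=k$ and diameter $d$. (i) $\Gamma$ is isomorphic to a subdigraph of $\overline{\Gamma}(d^{2k}+k,d)$. (ii) If $k\geq 2$, $d=3$ and $|V(\Gamma)|=3^{2k}+k$, then $\Gamma$ is isomorphic to a subdigraph of $\Gamma(3^{2k}+k,3)$. (iii) If $k\geq 2$ and $d\geq 4$, then $|V(\Gamma)|<d^{2k}+k$.
   Context: $\partial(x,y)$ is the length of a shortest directed path from $x$ to $y$, $\tilde\partial(x,y)=(\partial(x,y),\partial(y,x))$, diameter $=\max\partial(x,y)$. A vertex set $\{w_1,\dots,w_m\}$ is weakly resolving if $(\tilde\partial(w_1,u),\dots,\tilde\partial(w_m,u))\neq(\tilde\partial(w_1,v),\dots,\tilde\partial(w_m,v))$ for all distinct $u,v$; $\dim$ is the minimum size of such a set. For positive integers $k,d$, $\Gamma(d^{2k}+k,d)$ has vertex set $\{u_1,\dots,u_k\}\cup\{1,\dots,d\}^{2k}$ and its arcs are exactly: (F1) $(u_i,(a_1,\dots,a_{2k}))$ whenever $a_{2i-1}=1$; (F2) $((a_1,\dots,a_{2k}),u_i)$ whenever $a_{2i}=1$; (F3) $((a_1,\dots,a_{2k}),(b_1,\dots,b_{2k}))$ whenever the tuples are distinct and $a_{2r-1}-b_{2r-1}\geq-1$, $a_{2r}-b_{2r}\leq 1$ for all $r=1,\dots,k$. $\overline{\Gamma}(d^{2k}+k,d)$ is obtained by additionally adding arcs $(u_i,u_j)$ and $(u_j,u_i)$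 for all $1\leq i<j\leq k$. "Isomorphic to a subdigraph" means there is an injective vertex map sending arcs to arcs. -}

module Defs where

open import Data.Nat using (ℕ; zero; suc; _≤_; _<_)
open import Data.Fin using (Fin; toℕ)
open import Data.Bool using (Bool; true; false)
open import Data.Vec using (Vec; lookup)
open import Data.Product using (Σ; ∃; _×_; _,_; proj₁; proj₂)
open import Data.Empty using (⊥)
open import Data.Sum using (_⊎_; inj₁; inj₂)
open import Relation.Binary.PropositionalEquality using (_≡_; _≢_)
open import Function.Definitions using (Injective)

record Digraph : Set where
  field
    n     : ℕ
    arc   : Fin n → Fin n → Bool
    loopless : ∀ x → arc x x ≡ false

open Digraph public

Arc : (G : Digraph) → Fin (n G) → Fin (n G) → Set
Arc G x y = arc G x y ≡ true

data Walk (G : Digraph) : Fin (n G) → Fin (n G) → ℕ → Set where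
  here : ∀ {x} → Walk G x x zero
  step : ∀ {x y z ℓ} → Arc G x y → Walk G y z ℓ → Walk G x z (suc ℓ)

IsDist : (G : Digraph) → Fin (n G) → Fin (n G) → ℕ → Set
IsDist G x y m = Walk G x y m × (∀ ℓ → Walk G x y ℓ → m ≤ ℓ)

StronglyConnected : Digraph → Set
StronglyConnected G = ∀ x y → ∃ λ ℓ → Walk G x y ℓ

HasDiameter : Digraph → ℕ → Set
HasDiameter G d =
  (∀ x y → ∃ λ m → m ≤ d × IsDist G x y m) ×
  (∃ λ x → ∃ λ y → IsDist G x y d)

WeaklyResolving : (G : Digraph) {m : ℕ} → (Fin m → Fin (n G)) → Set
WeaklyResolving G {m} W =
  ∀ u v → u ≢ v → ∃ λ (i : Fin m) → ∃ λ a → ∃ λ b → a ≢ b ×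
    ((IsDist G (W i) u a × IsDist G (W i) v b) ⊎
     (IsDist G u (W i) a × IsDist G v (W i) b))

HasDim : Digraph → ℕ → Set
HasDim G k =
  (Σ (Fin k → Fin (n G)) (WeaklyResolving G)) ×
  (∀ m → m < k → (W : Fin m → Fin (n G)) → WeaklyResolving G W → ⊥)

-- Vertices of Γ(d^{2k}+k,d): u_1..u_k (as Fin k) and tuples in {1..d}^{2k},
-- stored as k pairs (a_{2r-1}, a_{2r}); coordinate value c ∈ {1..d} is
-- represented by c-1 ∈ Fin d (so "= 1" is toℕ ≡ 0).
GVertex : ℕ → ℕ → Set
GVertex k d = Fin k ⊎ Vec (Fin d × Fin d) k

data GArc (k d : ℕ) : GVertex k d → GVertex k d → Set where
  F1 : ∀ i (a : Vec (Fin d × Fin d) k) →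
       toℕ (proj₁ (lookup a i)) ≡ 0 →
       GArc k d (inj₁ i) (inj₂ a)
  F2 : ∀ i (a : Vec (Fin d × Fin d) k) →
       toℕ (proj₂ (lookup a i)) ≡ 0 →
       GArc k d (inj₂ a) (inj₁ i)
  -- a_{2r-1} - b_{2r-1} ≥ -1  ⇔  b_{2r-1} ≤ a_{2r-1} + 1
  -- a_{2r} - b_{2r} ≤ 1       ⇔  a_{2r} ≤ b_{2r} + 1
  F3 : ∀ (a b : Vec (Fin d × Fin d) k) → a ≢ b →
       (∀ r → toℕ (proj₁ (lookup b r)) ≤ suc (toℕ (proj₁ (lookup a r)))
            × toℕ (proj₂ (lookup a r)) ≤ suc (toℕ (proj₂ (lookup b r)))) →
       GArc k d (inj₂ a) (inj₂ b)

data GbarArc (k d : ℕ) : GVertex k d → GVertex k d → Set where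
  old : ∀ {x y} → GArc k d x y → GbarArc k d x y
  uu  : ∀ (i j : Fin k) → i ≢ j → GbarArc k d (inj₁ i) (inj₁ j)

EmbedsInto : (G : Digraph) {V : Set} → (V → V → Set) → Set
EmbedsInto G {V} R =
  Σ (Fin (n G) → V) λ f → Injective _≡_ _≡_ f × (∀ x y → Arc G x y → R (f x) (f y))

-- Send the landmark w_i of a weakly resolving set to u_i and every other vertex v to its
-- distance vector (∂(w_r,v), ∂(v,w_r))_r ∈ {1,…,d}^{2k}.  Resolvability makes this map
-- injective, and along an arc x → y the distance from a landmark grows by at most one while
-- the distance to a landmark drops by at most one, which are exactly the arc conditions
-- (F1)–(F3).  If |V| = d^{2k}+k the map is onto, so some vertex has distance vector
-- (1,…,1), giving ∂(w_i,w_j) ≤ 2, and some vertex is at distance d from w_i and 1 from w_j,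
-- giving d ≤ ∂(w_i,w_j) + 1.  Hence d ≤ 3, and for d = 3 no two landmarks are adjacent.
module Submission where

open import Defs
open import Data.Nat using (ℕ; _≤_; _<_; _+_; _*_; _^_)
open import Data.Product using (_×_)
open import Relation.Binary.PropositionalEquality using (_≡_)

open import Data.Nat.Base using (zero; suc; pred; >-nonZero; s≤s; s≤s⁻¹; z<s)
open import Data.Nat.Properties
  using (≤-refl; ≤-trans; ≤-reflexive; ≤-antisym; +-comm; +-monoˡ-≤; *-identityʳ;
         ^-*-assoc; pred-mono-≤; m≤pred[n]⇒suc[m]≤n; suc-pred; n≤0⇒n≡0; 1+n≰n; <⇒≱; ≤∧≢⇒<;
         module ≤-Reasoning)
open import Data.Fin.Base using (Fin; zero; suc; toℕ; fromℕ<; combine; join; splitAt; punchOut)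
open import Data.Fin.Properties
  using (_≟_; any?; toℕ-fromℕ<; combine-injective; splitAt-join; injective⇒≤; punchOut-injective)
open import Data.Vec.Base using (Vec; []; _∷_; lookup; tabulate; replicate; _[_]≔_)
open import Data.Vec.Properties using (lookup∘tabulate; lookup-replicate; lookup∘update; lookup∘update′)
open import Data.Product.Base using (∃; ∃₂; _,_; proj₁; proj₂)
open import Data.Sum.Base using (_⊎_; inj₁; inj₂)
open import Data.Sum.Properties using (inj₁-injective; inj₂-injective)
open import Data.Empty using (⊥; ⊥-elim)
open import Relation.Nullary using (¬_; yes; no; contradiction)
open import Relation.Binary.PropositionalEquality
  using (_≢_; refl; sym; trans; cong; cong₂; subst; subst₂; module ≡-Reasoning)
open import Relation.Binary.PropositionalEquality.Properties using (subst-injective)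
open import Function.Base using (_∘_)
open import Function.Definitions using (Injective)

pred[m]<n : ∀ {m n} → 0 < n → m ≤ n → pred m < n
pred[m]<n 0<n m≤n = m≤pred[n]⇒suc[m]≤n {{>-nonZero 0<n}} (pred-mono-≤ m≤n)

≡suc∧≤1⇒≡0 : ∀ {m t} → m ≡ suc t → m ≤ 1 → t ≡ 0
≡suc∧≤1⇒≡0 m≡1+t m≤1 = n≤0⇒n≡0 (s≤s⁻¹ (subst (_≤ 1) m≡1+t m≤1))

injective⇒surjective : ∀ {m n} → m ≡ n → {f : Fin m → Fin n} → Injective _≡_ _≡_ f →
                       ∀ j → ∃ λ i → f i ≡ j
injective⇒surjective {suc m} refl {f} f-injective j with any? (λ i → f i ≟ j)
... | yes hit = hit
... | no miss = contradiction (injective⇒≤ f′-injective) 1+n≰n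
  where
  j≢f : ∀ i → j ≢ f i
  j≢f i j≡fi = miss (i , sym j≡fi)

  f′ : Fin (suc m) → Fin m
  f′ i = punchOut (j≢f i)

  f′-injective : Injective _≡_ _≡_ f′
  f′-injective {x} {y} f′x≡f′y = f-injective (punchOut-injective (j≢f x) (j≢f y) f′x≡f′y)

distinct-pair : ∀ {k} → 2 ≤ k → ∃₂ λ (i j : Fin k) → i ≢ j
distinct-pair (s≤s (s≤s _)) = zero , suc zero , λ ()

tupleCode : ∀ {k d} → Vec (Fin d × Fin d) k → Fin ((d * d) ^ k)
tupleCode []             = zero
tupleCode ((a , b) ∷ xs) = combine (combine a b) (tupleCode xs)

tupleCode-injective : ∀ {k d} → Injective _≡_ _≡_ (tupleCode {k} {d})
tupleCode-injective {x = []} {[]} _ = refl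
tupleCode-injective {x = (a , b) ∷ xs} {(a′ , b′) ∷ ys} e
  with ab≡a′b′ , xs≡ys ← combine-injective (combine a b) _ (combine a′ b′) _ e
  with refl , refl ← combine-injective a b a′ b′ ab≡a′b′
  = cong ((a , b) ∷_) (tupleCode-injective xs≡ys)

[d*d]^k≡d^[2*k] : ∀ d k → (d * d) ^ k ≡ d ^ (2 * k)
[d*d]^k≡d^[2*k] d k = trans (cong (λ e → (d * e) ^ k) (sym (*-identityʳ d))) (^-*-assoc d 2 k)

vertexCode⊎ : ∀ {k d} → GVertex k d → Fin (d ^ (2 * k)) ⊎ Fin k
vertexCode⊎ (inj₁ i) = inj₂ i
vertexCode⊎ {k} {d} (inj₂ a) = inj₁ (subst Fin ([d*d]^k≡d^[2*k] d k) (tupleCode a))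

vertexCode⊎-injective : ∀ {k d} → Injective _≡_ _≡_ (vertexCode⊎ {k} {d})
vertexCode⊎-injective {x = inj₁ _} {inj₁ _} e = cong inj₁ (inj₂-injective e)
vertexCode⊎-injective {k} {d} {inj₂ _} {inj₂ _} e =
  cong inj₂ (tupleCode-injective (subst-injective ([d*d]^k≡d^[2*k] d k) (inj₁-injective e)))

vertexCode : ∀ {k d} → GVertex k d → Fin (d ^ (2 * k) + k)
vertexCode {k} {d} = join (d ^ (2 * k)) k ∘ vertexCode⊎

vertexCode-injective : ∀ {k d} → Injective _≡_ _≡_ (vertexCode {k} {d})
vertexCode-injective {k} {d} {x} {y} e = vertexCode⊎-injective (begin
  vertexCode⊎ x                 ≡⟨ sym (splitAt-join (d ^ (2 * k)) k (vertexCode⊎ x)) ⟩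
  splitAt _ (vertexCode x)      ≡⟨ cong (splitAt _) e ⟩
  splitAt _ (vertexCode y)      ≡⟨ splitAt-join (d ^ (2 * k)) k (vertexCode⊎ y) ⟩
  vertexCode⊎ y                 ∎)
  where open ≡-Reasoning

GbarArc⇒GArc : ∀ {k d p q} → (∀ i j → p ≡ inj₁ i → q ≡ inj₁ j → ⊥) →
               GbarArc k d p q → GArc k d p q
GbarArc⇒GArc _     (old a)    = a
GbarArc⇒GArc no-uu (uu i j _) = ⊥-elim (no-uu i j refl refl)

_++ʷ_ : ∀ {G x y z a b} → Walk G x y a → Walk G y z b → Walk G x z (a + b)
here     ++ʷ q = q
step e p ++ʷ q = step e (p ++ʷ q)

arc⇒≢ : ∀ (G : Digraph) {x y} → Arc G x y → x ≢ y
arc⇒≢ G {x} a refl = contradiction (trans (sym a) (loopless G x)) λ ()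

module Distance (G : Digraph) {d : ℕ} (D : ∀ x y → ∃ λ m → m ≤ d × IsDist G x y m) where

  ∂ : Fin (n G) → Fin (n G) → ℕ
  ∂ x y = proj₁ (D x y)

  ∂≤d : ∀ x y → ∂ x y ≤ d
  ∂≤d x y = proj₁ (proj₂ (D x y))

  ∂-walk : ∀ x y → Walk G x y (∂ x y)
  ∂-walk x y = proj₁ (proj₂ (proj₂ (D x y)))

  ∂-minimal : ∀ {x y ℓ} → Walk G x y ℓ → ∂ x y ≤ ℓ
  ∂-minimal {x} {y} = proj₂ (proj₂ (proj₂ (D x y))) _

  ∂-unique : ∀ {x y m} → IsDist G x y m → ∂ x y ≡ m
  ∂-unique {x} {y} (walk , minimal) = ≤-antisym (∂-minimal walk) (minimal _ (∂-walk x y))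

  ∂-pos : ∀ {x y} → x ≢ y → 0 < ∂ x y
  ∂-pos {x} {y} x≢y with ∂ x y | ∂-walk x y
  ... | zero  | here = contradiction refl x≢y
  ... | suc _ | _    = z<s

  ∂-triangle : ∀ x y z → ∂ x z ≤ ∂ x y + ∂ y z
  ∂-triangle x y z = ∂-minimal (∂-walk x y ++ʷ ∂-walk y z)

  ∂-arc : ∀ {x y} → Arc G x y → ∂ x y ≤ 1
  ∂-arc a = ∂-minimal (step a here)

  ∂-arc-out : ∀ {x y z} → Arc G x y → ∂ z y ≤ suc (∂ z x)
  ∂-arc-out {x} {z = z} a =
    ≤-trans (∂-minimal (∂-walk z x ++ʷ step a here)) (≤-reflexive (+-comm (∂ z x) 1))

  ∂-arc-in : ∀ {x y z} → Arc G x y → ∂ x z ≤ suc (∂ y z)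
  ∂-arc-in {y = y} {z} a = ∂-minimal (step a (∂-walk y z))

  ≡-distances⇒≡ : ∀ {k} {W : Fin k → Fin (n G)} → WeaklyResolving G W →
                  ∀ {u v} → (∀ r → ∂ (W r) u ≡ ∂ (W r) v × ∂ u (W r) ≡ ∂ v (W r)) → u ≡ v
  ≡-distances⇒≡ W-resolving {u} {v} same with u ≟ v
  ... | yes u≡v = u≡v
  ... | no u≢v with W-resolving u v u≢v
  ...   | r , a , b , a≢b , inj₁ (du , dv) =
          contradiction (trans (sym (∂-unique du)) (trans (proj₁ (same r)) (∂-unique dv))) a≢b
  ...   | r , a , b , a≢b , inj₂ (du , dv) =
          contradiction (trans (sym (∂-unique du)) (trans (proj₂ (same r)) (∂-unique dv))) a≢b

module Embedding (k d : ℕ) (0<d : 0 < d) (G : Digraph)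
                 (D : ∀ x y → ∃ λ m → m ≤ d × IsDist G x y m)
                 (W : Fin k → Fin (n G)) (W-resolving : WeaklyResolving G W) where

  open Distance G D

  V : Set
  V = Fin (n G)

  Tuple : Set
  Tuple = Vec (Fin d × Fin d) k

  NonLandmark : V → Set
  NonLandmark v = ∀ i → W i ≢ v

  _Realises_ : V → Tuple → Set
  v Realises a = ∀ r → ∂ (W r) v ≡ suc (toℕ (proj₁ (lookup a r)))
                     × ∂ v (W r) ≡ suc (toℕ (proj₂ (lookup a r)))

  realisers-unique : ∀ {u v a} → u Realises a → v Realises a → u ≡ v
  realisers-unique u-realises v-realises = ≡-distances⇒≡ W-resolving λ r →
    trans (proj₁ (u-realises r)) (sym (proj₁ (v-realises r))) ,
    trans (proj₂ (u-realises r)) (sym (proj₂ (v-realises r)))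

  coord : V → V → Fin d
  coord x y = fromℕ< (pred[m]<n 0<d (∂≤d x y))

  coord-correct : ∀ {x y} → x ≢ y → ∂ x y ≡ suc (toℕ (coord x y))
  coord-correct {x} {y} x≢y = trans (sym (suc-pred (∂ x y) {{>-nonZero (∂-pos x≢y)}}))
                                    (cong suc (sym (toℕ-fromℕ< _)))

  profile : V → Tuple
  profile v = tabulate λ r → coord (W r) v , coord v (W r)

  profile-realises : ∀ {v} → NonLandmark v → v Realises profile v
  profile-realises {v} v-nl r rewrite lookup∘tabulate (λ r → coord (W r) v , coord v (W r)) r =
    coord-correct (v-nl r) , coord-correct (v-nl r ∘ sym)

  profile-injective : ∀ {u v} → NonLandmark u → NonLandmark v → profile u ≡ profile v → u ≡ v
  profile-injective {u} {v} u-nl v-nl pu≡pv =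
    realisers-unique {a = profile u} (profile-realises u-nl)
                     (subst (v Realises_) (sym pu≡pv) (profile-realises v-nl))

  profile-arc : ∀ {x y} → Arc G x y → NonLandmark x → NonLandmark y → ∀ r →
                toℕ (proj₁ (lookup (profile y) r)) ≤ suc (toℕ (proj₁ (lookup (profile x) r)))
                × toℕ (proj₂ (lookup (profile x) r)) ≤ suc (toℕ (proj₂ (lookup (profile y) r)))
  profile-arc a x-nl y-nl r with profile-realises x-nl r | profile-realises y-nl r
  ... | out-x , in-x | out-y , in-y =
    s≤s⁻¹ (subst₂ _≤_ out-y (cong suc out-x) (∂-arc-out a)) ,
    s≤s⁻¹ (subst₂ _≤_ in-x (cong suc in-y) (∂-arc-in a))

  embed : V → GVertex k d
  embed v with any? (λ i → W i ≟ v)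
  ... | yes (i , _) = inj₁ i
  ... | no _        = inj₂ (profile v)

  data EmbedView (v : V) : GVertex k d → Set where
    landmark : ∀ i → W i ≡ v → EmbedView v (inj₁ i)
    other    : NonLandmark v → EmbedView v (inj₂ (profile v))

  embed-view : ∀ v → EmbedView v (embed v)
  embed-view v with any? (λ i → W i ≟ v)
  ... | yes (i , wᵢ≡v) = landmark i wᵢ≡v
  ... | no ¬landmark   = other λ i wᵢ≡v → ¬landmark (i , wᵢ≡v)

  embed≡inj₁ : ∀ {v i} → embed v ≡ inj₁ i → W i ≡ v
  embed≡inj₁ {v} e with embed v | embed-view v
  embed≡inj₁ refl | _ | landmark _ wᵢ≡v = wᵢ≡v
  embed≡inj₁ ()   | _ | other _

  embed≡inj₂ : ∀ {v a} → embed v ≡ inj₂ a → v Realises a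
  embed≡inj₂ {v} e with embed v | embed-view v
  embed≡inj₂ ()   | _ | landmark _ _
  embed≡inj₂ refl | _ | other v-nl = profile-realises v-nl

  embed-injective : Injective _≡_ _≡_ embed
  embed-injective {u} {v} e with embed u | embed-view u | embed v | embed-view v
  embed-injective refl | _ | landmark _ wᵢ≡u | _ | landmark _ wᵢ≡v = trans (sym wᵢ≡u) wᵢ≡v
  embed-injective ()   | _ | landmark _ _    | _ | other _
  embed-injective ()   | _ | other _         | _ | landmark _ _
  embed-injective e    | _ | other u-nl      | _ | other v-nl =
    profile-injective u-nl v-nl (inj₂-injective e)

  embed-arc-Γ̄ : ∀ {x y} → Arc G x y → GbarArc k d (embed x) (embed y)
  embed-arc-Γ̄ {x} {y} a with embed x | embed-view x | embed y | embed-view y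
  ... | _ | landmark i refl | _ | landmark j refl = uu i j λ { refl → arc⇒≢ G a refl }
  ... | _ | landmark i refl | _ | other y-nl =
    old (F1 i (profile y) (≡suc∧≤1⇒≡0 (proj₁ (profile-realises y-nl i)) (∂-arc a)))
  ... | _ | other x-nl | _ | landmark j refl =
    old (F2 j (profile x) (≡suc∧≤1⇒≡0 (proj₂ (profile-realises x-nl j)) (∂-arc a)))
  ... | _ | other x-nl | _ | other y-nl =
    old (F3 (profile x) (profile y) (arc⇒≢ G a ∘ profile-injective x-nl y-nl)
            (profile-arc a x-nl y-nl))

  embed-arc-Γ : (∀ i j → ¬ Arc G (W i) (W j)) → ∀ {x y} → Arc G x y → GArc k d (embed x) (embed y)
  embed-arc-Γ no-arc a = GbarArc⇒GArc (λ i j ex ey →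
    no-arc i j (subst₂ (Arc G) (sym (embed≡inj₁ ex)) (sym (embed≡inj₁ ey)) a)) (embed-arc-Γ̄ a)

  embeds-in-Γ̄ : EmbedsInto G (GbarArc k d)
  embeds-in-Γ̄ = embed , embed-injective , λ _ _ → embed-arc-Γ̄

  embeds-in-Γ : (∀ i j → ¬ Arc G (W i) (W j)) → EmbedsInto G (GArc k d)
  embeds-in-Γ no-arc = embed , embed-injective , λ _ _ → embed-arc-Γ no-arc

  code-injective : Injective _≡_ _≡_ (vertexCode ∘ embed)
  code-injective = embed-injective ∘ vertexCode-injective

  n≤d^[2k]+k : n G ≤ d ^ (2 * k) + k
  n≤d^[2k]+k = injective⇒≤ code-injective

  module Saturated (n≡d^[2k]+k : n G ≡ d ^ (2 * k) + k) where

    realised : ∀ a → ∃ λ v → v Realises a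
    realised a with v , e ← injective⇒surjective n≡d^[2k]+k code-injective (vertexCode (inj₂ a)) =
      v , embed≡inj₂ (vertexCode-injective {y = inj₂ a} e)

    lowest highest : Fin d
    lowest  = fromℕ< 0<d
    highest = fromℕ< (pred[m]<n 0<d ≤-refl)

    toℕ-lowest : toℕ lowest ≡ 0
    toℕ-lowest = toℕ-fromℕ< 0<d

    suc-toℕ-highest : suc (toℕ highest) ≡ d
    suc-toℕ-highest = trans (cong suc (toℕ-fromℕ< _)) (suc-pred d {{>-nonZero 0<d}})

    base : Tuple
    base = replicate k (lowest , lowest)

    spike : Fin k → Tuple
    spike i = base [ i ]≔ (highest , lowest)

    landmark-∂≤2 : ∀ i j → ∂ (W i) (W j) ≤ 2
    landmark-∂≤2 i j with v , v-realises ← realised base = begin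
      ∂ (W i) (W j)                  ≤⟨ ∂-triangle (W i) v (W j) ⟩
      ∂ (W i) v + ∂ v (W j)          ≡⟨ cong₂ _+_ (proj₁ (v-realises i)) (proj₂ (v-realises j)) ⟩
      suc (toℕ (proj₁ (lookup base i))) + suc (toℕ (proj₂ (lookup base j)))
        ≡⟨ cong₂ (λ p q → suc (toℕ (proj₁ p)) + suc (toℕ (proj₂ q)))
                 (lookup-replicate i _) (lookup-replicate j _) ⟩
      suc (toℕ lowest) + suc (toℕ lowest) ≡⟨ cong (λ t → suc t + suc t) toℕ-lowest ⟩
      2                              ∎
      where open ≤-Reasoning

    d≤landmark-∂+1 : ∀ {i j} → i ≢ j → d ≤ ∂ (W i) (W j) + 1
    d≤landmark-∂+1 {i} {j} i≢j with v , v-realises ← realised (spike i) = begin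
      d                              ≡⟨ sym suc-toℕ-highest ⟩
      suc (toℕ highest)              ≡⟨ cong (suc ∘ toℕ ∘ proj₁) (sym (lookup∘update i base _)) ⟩
      suc (toℕ (proj₁ (lookup (spike i) i))) ≡⟨ sym (proj₁ (v-realises i)) ⟩
      ∂ (W i) v                      ≤⟨ ∂-triangle (W i) (W j) v ⟩
      ∂ (W i) (W j) + ∂ (W j) v      ≡⟨ cong (∂ (W i) (W j) +_) (proj₁ (v-realises j)) ⟩
      ∂ (W i) (W j) + suc (toℕ (proj₁ (lookup (spike i) j)))
        ≡⟨ cong (λ p → ∂ (W i) (W j) + suc (toℕ (proj₁ p)))
                (trans (lookup∘update′ (i≢j ∘ sym) base _) (lookup-replicate j _)) ⟩
      ∂ (W i) (W j) + suc (toℕ lowest) ≡⟨ cong (λ t → ∂ (W i) (W j) + suc t) toℕ-lowest ⟩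
      ∂ (W i) (W j) + 1              ∎
      where open ≤-Reasoning

    d≤3 : ∀ {i j} → i ≢ j → d ≤ 3
    d≤3 {i} {j} i≢j = ≤-trans (d≤landmark-∂+1 i≢j) (+-monoˡ-≤ 1 (landmark-∂≤2 i j))

    no-landmark-arcs : d ≡ 3 → ∀ i j → ¬ Arc G (W i) (W j)
    no-landmark-arcs d≡3 i j a with i ≟ j
    ... | yes refl = arc⇒≢ G a refl
    ... | no i≢j   = 1+n≰n (≤-trans (subst (_≤ ∂ (W i) (W j) + 1) d≡3 (d≤landmark-∂+1 i≢j))
                                    (+-monoˡ-≤ 1 (∂-arc a)))

lemma2p6 : (k d : ℕ) → 1 ≤ k → 1 ≤ d →
    (G : Digraph) → StronglyConnected G → HasDim G k → HasDiameter G d →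
      EmbedsInto G (GbarArc k d)
      × (2 ≤ k → d ≡ 3 → n G ≡ 3 ^ (2 * k) + k → EmbedsInto G (GArc k 3))
      × (2 ≤ k → 4 ≤ d → n G < d ^ (2 * k) + k)
lemma2p6 k d _ 0<d G _ ((W , W-resolving) , _) (D , _) =
    embeds-in-Γ̄
  , (λ { _ refl n≡3^[2k]+k → embeds-in-Γ (Saturated.no-landmark-arcs n≡3^[2k]+k refl) })
  , λ 2≤k 4≤d → ≤∧≢⇒< n≤d^[2k]+k λ n≡d^[2k]+k →
      <⇒≱ 4≤d (Saturated.d≤3 n≡d^[2k]+k (proj₂ (proj₂ (distinct-pair 2≤k))))
  where open Embedding k d 0<d G D W W-resolving
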